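{- Let $G=(V,E)$ be a graph and let $X=\{x_1,\dots,x_{2\ell+1}\}$ where $x_i\in\mathcal{P}(G)$ for every $i$. Suppose $\|\mathrm{median}\{x_i: x_i\in X\}\|_1>0$. Then $R_{\mathrm{med}}(G,X)\in\mathcal{P}(G)$.
   Context: Graphs are finite directed graphs; vertices with no out-edges carry a self-loop. A ranking (reset) vector is $x:V\to[0,1]$ with $\sum_v x[v]=1$. $\mathrm{PR}(G,r,\varepsilon)$ is the unique stationary distribution of the chain with transition matrix $(1-\varepsilon)M+\varepsilon R$, $M[u,v]=1/d_{out}(u)$ for $(u,v)\in E$ (else 0), $R[u,v]=r[v]$. $\mathcal{P}(G)=\{\mathrm{PR}(G,r,\varepsilon): r\text{ a ranking vector},\ \varepsilon\in(0,1)\}$. The median is component-wise, and $R_{\mathrm{med}}(G,X)=\mathrm{median}\{x_i\}/\|\mathrm{median}\{x_i\}\|_1$. -}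

module Defs where

open import Level using (0ℓ)
open import Data.Nat as ℕ using (ℕ; zero; suc)
open import Data.Fin using (Fin; zero; suc; fromℕ; _↑ˡ_)
open import Data.Vec using (Vec; []; _∷_; lookup; map)
open import Data.Bool using (Bool; true; false; if_then_else_)
open import Data.Product using (Σ; ∃; _×_; _,_)
open import Relation.Binary.PropositionalEquality using (_≡_; _≢_)
open import Relation.Binary.Definitions using (Tri; tri<; tri≈; tri>)
open import Relation.Nullary using (¬_)
open import Data.Sum using (_⊎_)
import Algebra.Structures as AS
import Relation.Binary.Structures as RS

-- Any model of
-- this record is isomorphic to ℝ; the theorem is stated for every model.

record Reals : Set₁ where
  infixl 6 _+_ _-_
  infixl 7 _*_
  infix  4 _<_ _≤_
  field
    ℝ     : Set
    0ℝ 1ℝ : ℝ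
    _+_ _*_ : ℝ → ℝ → ℝ
    -_    : ℝ → ℝ
    _⁻¹   : ℝ → ℝ
    _<_   : ℝ → ℝ → Set
    isCommutativeRing : AS.IsCommutativeRing {A = ℝ} _≡_ _+_ _*_ -_ 0ℝ 1ℝ
    0≢1   : 0ℝ ≢ 1ℝ
    ⁻¹-inverse : ∀ x → x ≢ 0ℝ → x * (x ⁻¹) ≡ 1ℝ
    isStrictTotalOrder : RS.IsStrictTotalOrder {A = ℝ} _≡_ _<_
    +-mono-< : ∀ {x y} z → x < y → x + z < y + z
    *-pos    : ∀ {x y} → 0ℝ < x → 0ℝ < y → 0ℝ < x * y

  _≤_ : ℝ → ℝ → Set
  x ≤ y = x < y ⊎ x ≡ y

  _-_ : ℝ → ℝ → ℝ
  x - y = x + (- y)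

  field
    completeness : (P : ℝ → Set) → (∃ λ x → P x) →
                   (∃ λ b → ∀ x → P x → x ≤ b) →
                   ∃ λ s → (∀ x → P x → x ≤ s) ×
                           (∀ b → (∀ x → P x → x ≤ b) → s ≤ b)

  open RS.IsStrictTotalOrder isStrictTotalOrder public using (compare)

  ∣_∣ : ℝ → ℝ
  ∣ x ∣ with compare x 0ℝ
  ... | tri< _ _ _ = - x
  ... | tri≈ _ _ _ = x
  ... | tri> _ _ _ = x

  Σ[_] : ∀ {n} → (Fin n → ℝ) → ℝ
  Σ[_] {zero}  f = 0ℝ
  Σ[_] {suc n} f = f zero + Σ[ (λ i → f (suc i)) ]

  ‖_‖₁ : ∀ {n} → (Fin n → ℝ) → ℝ
  ‖ x ‖₁ = Σ[ (λ v → ∣ x v ∣) ]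

  insert : ∀ {k} → ℝ → Vec ℝ k → Vec ℝ (suc k)
  insert a [] = a ∷ []
  insert a (b ∷ bs) with compare a b
  ... | tri< _ _ _ = a ∷ b ∷ bs
  ... | tri≈ _ _ _ = a ∷ b ∷ bs
  ... | tri> _ _ _ = b ∷ insert a bs

  sort : ∀ {k} → Vec ℝ k → Vec ℝ k
  sort []       = []
  sort (a ∷ as) = insert a (sort as)

  -- median of 2ℓ+1 reals: the (ℓ+1)-st smallest
  median : ∀ ℓ → Vec ℝ (suc (ℓ ℕ.+ ℓ)) → ℝ
  median ℓ xs = lookup (sort xs) (fromℕ ℓ ↑ˡ ℓ)

  -- Graphs on vertex set Fin n.  Following the standing convention,
  -- vertices without out-edges carry a self-loop, so every vertex has
  -- an out-neighbour.

  record Graph (n : ℕ) : Set where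
    field
      edge   : Fin n → Fin n → Bool
      hasOut : ∀ u → ∃ λ v → edge u v ≡ true

  module _ {n : ℕ} (G : Graph n) where
    open Graph G

    outdeg : Fin n → ℝ
    outdeg u = Σ[ (λ v → if edge u v then 1ℝ else 0ℝ) ]

    M : Fin n → Fin n → ℝ
    M u v = if edge u v then outdeg u ⁻¹ else 0ℝ

  IsRanking : ∀ {n} → (Fin n → ℝ) → Set
  IsRanking x = (∀ v → 0ℝ ≤ x v × x v ≤ 1ℝ) × Σ[ x ] ≡ 1ℝ

  -- x is a stationary distribution of (1-ε)M + εR, R[u,v] = r[v].
  -- Since that stationary distribution is unique, this says x = PR(G,r,ε).
  IsPR : ∀ {n} → Graph n → (r : Fin n → ℝ) → (ε : ℝ) → (x : Fin n → ℝ) → Set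
  IsPR G r ε x = IsRanking x ×
    (∀ v → x v ≡ Σ[ (λ u → x u * ((1ℝ - ε) * M G u v + ε * r v)) ])

  _∈𝒫_ : ∀ {n} → (Fin n → ℝ) → Graph n → Set
  x ∈𝒫 G = ∃ λ r → ∃ λ ε → IsRanking r × (0ℝ < ε × ε < 1ℝ) × IsPR G r ε x

  medianVec : ∀ {n} ℓ → Vec (Fin n → ℝ) (suc (ℓ ℕ.+ ℓ)) → Fin n → ℝ
  medianVec ℓ X v = median ℓ (map (λ x → x v) X)

  Rmed : ∀ {n} ℓ → Vec (Fin n → ℝ) (suc (ℓ ℕ.+ ℓ)) → Fin n → ℝ
  Rmed ℓ X v = medianVec ℓ X v * (‖ medianVec ℓ X ‖₁ ⁻¹)

-- A ranking vector x lies in 𝒫(G) exactly when every in-neighbour of a zero of x is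
-- itself a zero of x.  Necessity: x v = Σᵤ x u ((1 - ε) M u v + ε r v) is a sum of
-- nonnegative terms whose coefficient is positive along each edge u → v.  Sufficiency:
-- y = xM is again a probability vector vanishing wherever x does, so δ y ≤ x for some
-- δ ∈ (0,1), and x = δ xM + (1 - δ) r for the ranking vector r = (x - δ y) / (1 - δ),
-- i.e. x = PR(G, r, 1 - δ).  The median at v of 2ℓ+1 nonnegative reals vanishes exactly
-- when more than ℓ of them do, so it inherits nonnegativity and the closure property
-- from the xᵢ, and so does its normalisation.
module Submission where

open import Defs
open import Data.Nat as ℕ using (ℕ; suc)
open import Data.Fin using (Fin)
open import Data.Vec using (Vec)
open import Data.Vec.Relation.Unary.All using (All)

open import Algebra.Bundles using (CommutativeRing)
open import Data.Bool using (true; false; if_then_else_)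
open import Data.Empty using (⊥-elim)
open import Data.Nat using (zero)
open import Data.Fin using (zero; suc; toℕ; fromℕ; _↑ˡ_)
import Data.Fin.Properties as FinP
import Data.Nat.Properties as ℕP
open import Data.Product using (∃; _×_; _,_; proj₁)
open import Data.Sum using (inj₁; inj₂)
open import Data.Vec using ([]; _∷_; lookup; map; count)
open import Data.Vec.Relation.Unary.All using ([]; _∷_)
import Data.Vec.Relation.Unary.All as All
open import Data.Vec.Relation.Unary.All.Properties using (lookup⁺; map⁺)
open import Function using (_∘_)
open import Relation.Binary.Definitions using (tri<; tri≈; tri>)
open import Relation.Binary.PropositionalEquality
import Relation.Binary.Structures as Structures
open import Relation.Nullary using (¬_; yes; no)

module OrderedField (R : Reals) where
  open Reals R
  open Structures.IsStrictTotalOrder isStrictTotalOrder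
    public using (_≟_) renaming (trans to <-trans; irrefl to <-irrefl; asym to <-asym)

  commutativeRing : CommutativeRing _ _
  commutativeRing = record { isCommutativeRing = isCommutativeRing }

  open CommutativeRing commutativeRing public
    using ( +-comm; +-identityˡ; +-identityʳ; -‿inverseʳ
          ; *-identityˡ; *-identityʳ; distribˡ; distribʳ; zeroˡ; zeroʳ
          ; ring; +-group; +-abelianGroup; *-commutativeSemigroup; semiring )
  open import Algebra.Properties.Ring ring public
    using (-‿distribˡ-*; -‿distribʳ-*; -‿involutive; x[y-z]≈xy-xz; -1*x≈-x)
  open import Algebra.Properties.Group +-group public using (//-rightDividesˡ; //-rightDividesʳ)
  open import Algebra.Properties.AbelianGroup +-abelianGroup public using (⁻¹-anti-homo‿-)
  open import Algebra.Properties.CommutativeSemigroup *-commutativeSemigroup public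
    using (x∙yz≈y∙xz)

  <⇒≢ : ∀ {x y} → x < y → x ≢ y
  <⇒≢ x<y refl = <-irrefl refl x<y

  ≤⇒≯ : ∀ {x y} → x ≤ y → ¬ y < x
  ≤⇒≯ (inj₁ x<y) y<x = <-asym x<y y<x
  ≤⇒≯ (inj₂ refl) y<x = <-irrefl refl y<x

  ≤-antisym : ∀ {x y} → x ≤ y → y ≤ x → x ≡ y
  ≤-antisym (inj₁ x<y) y≤x = ⊥-elim (≤⇒≯ y≤x x<y)
  ≤-antisym (inj₂ x≡y) _ = x≡y

  ≤-trans : ∀ {x y z} → x ≤ y → y ≤ z → x ≤ z
  ≤-trans (inj₁ x<y) (inj₁ y<z) = inj₁ (<-trans x<y y<z)
  ≤-trans x≤y (inj₂ refl) = x≤y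
  ≤-trans (inj₂ refl) y≤z = y≤z

  <-≤-trans : ∀ {x y z} → x < y → y ≤ z → x < z
  <-≤-trans x<y (inj₁ y<z) = <-trans x<y y<z
  <-≤-trans x<y (inj₂ refl) = x<y

  +-monoˡ-≤ : ∀ {x y} z → x ≤ y → x + z ≤ y + z
  +-monoˡ-≤ z (inj₁ x<y) = inj₁ (+-mono-< z x<y)
  +-monoˡ-≤ z (inj₂ refl) = inj₂ refl

  +-monoʳ-≤ : ∀ {x y} z → x ≤ y → z + x ≤ z + y
  +-monoʳ-≤ {x} {y} z x≤y = subst₂ _≤_ (+-comm x z) (+-comm y z) (+-monoˡ-≤ z x≤y)

  +-mono-≤ : ∀ {x y z w} → x ≤ y → z ≤ w → x + z ≤ y + w
  +-mono-≤ {y = y} {z} x≤y z≤w = ≤-trans (+-monoˡ-≤ z x≤y) (+-monoʳ-≤ y z≤w)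

  +-nonneg : ∀ {x y} → 0ℝ ≤ x → 0ℝ ≤ y → 0ℝ ≤ x + y
  +-nonneg 0≤x 0≤y = subst (_≤ _) (+-identityˡ 0ℝ) (+-mono-≤ 0≤x 0≤y)

  +-pos-nonneg : ∀ {x y} → 0ℝ < x → 0ℝ ≤ y → 0ℝ < x + y
  +-pos-nonneg {x} {y} 0<x 0≤y = <-≤-trans 0<x (subst (_≤ x + y) (+-identityʳ x) (+-monoʳ-≤ x 0≤y))

  x<y⇒0<y-x : ∀ {x y} → x < y → 0ℝ < y - x
  x<y⇒0<y-x {x} x<y = subst (_< _) (-‿inverseʳ x) (+-mono-< (- x) x<y)

  0<y-x⇒x<y : ∀ {x y} → 0ℝ < y - x → x < y
  0<y-x⇒x<y {x} {y} 0<y-x = subst₂ _<_ (+-identityˡ x) (//-rightDividesˡ x y) (+-mono-< x 0<y-x)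

  x≤y⇒0≤y-x : ∀ {x y} → x ≤ y → 0ℝ ≤ y - x
  x≤y⇒0≤y-x (inj₁ x<y) = inj₁ (x<y⇒0<y-x x<y)
  x≤y⇒0≤y-x {x} (inj₂ refl) = inj₂ (sym (-‿inverseʳ x))

  0≤y-x⇒x≤y : ∀ {x y} → 0ℝ ≤ y - x → x ≤ y
  0≤y-x⇒x≤y (inj₁ 0<y-x) = inj₁ (0<y-x⇒x<y 0<y-x)
  0≤y-x⇒x≤y {x} {y} (inj₂ 0≡y-x) =
    inj₂ (trans (sym (+-identityˡ x)) (trans (cong (_+ x) 0≡y-x) (//-rightDividesˡ x y)))

  x+[y-x]≡y : ∀ x y → x + (y - x) ≡ y
  x+[y-x]≡y x y = trans (+-comm x (y - x)) (//-rightDividesˡ x y)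

  x-[x-y]≡y : ∀ x y → x - (x - y) ≡ y
  x-[x-y]≡y x y = trans (cong (x +_) (⁻¹-anti-homo‿- x y)) (x+[y-x]≡y x y)

  0<1 : 0ℝ < 1ℝ
  0<1 with compare 0ℝ 1ℝ
  ... | tri< 0<1 _ _ = 0<1
  ... | tri≈ _ 0≡1 _ = ⊥-elim (0≢1 0≡1)
  ... | tri> _ _ 1<0 = ⊥-elim (<-asym 1<0 (subst (0ℝ <_) [-1][-1]≡1 (*-pos 0<-1 0<-1)))
    where
    0<-1 : 0ℝ < - 1ℝ
    0<-1 = subst (0ℝ <_) (+-identityˡ (- 1ℝ)) (x<y⇒0<y-x 1<0)
    [-1][-1]≡1 : - 1ℝ * - 1ℝ ≡ 1ℝ
    [-1][-1]≡1 = trans (sym (-‿distribˡ-* 1ℝ (- 1ℝ)))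
                       (trans (cong -_ (*-identityˡ (- 1ℝ))) (-‿involutive 1ℝ))

  *-nonneg : ∀ {x y} → 0ℝ ≤ x → 0ℝ ≤ y → 0ℝ ≤ x * y
  *-nonneg (inj₁ 0<x) (inj₁ 0<y) = inj₁ (*-pos 0<x 0<y)
  *-nonneg {x} _ (inj₂ refl) = inj₂ (sym (zeroʳ x))
  *-nonneg {y = y} (inj₂ refl) _ = inj₂ (sym (zeroˡ y))

  *-monoˡ-≤-nonneg : ∀ {z x y} → 0ℝ ≤ z → x ≤ y → z * x ≤ z * y
  *-monoˡ-≤-nonneg {z} {x} {y} 0≤z x≤y =
    0≤y-x⇒x≤y (subst (0ℝ ≤_) (x[y-z]≈xy-xz z y x) (*-nonneg 0≤z (x≤y⇒0≤y-x x≤y)))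

  ⁻¹-pos : ∀ {x} → 0ℝ < x → 0ℝ < x ⁻¹
  ⁻¹-pos {x} 0<x with compare 0ℝ (x ⁻¹)
  ... | tri< 0<x⁻¹ _ _ = 0<x⁻¹
  ... | tri≈ _ 0≡x⁻¹ _ = ⊥-elim (0≢1 (begin
    0ℝ          ≡⟨ sym (zeroʳ x) ⟩
    x * 0ℝ      ≡⟨ cong (x *_) 0≡x⁻¹ ⟩
    x * x ⁻¹    ≡⟨ ⁻¹-inverse x (≢-sym (<⇒≢ 0<x)) ⟩
    1ℝ          ∎))
    where open ≡-Reasoning
  ... | tri> _ _ x⁻¹<0 =
    ⊥-elim (<-asym 0<1 (0<y-x⇒x<y (subst (0ℝ <_) x*-x⁻¹≡0-1 (*-pos 0<x 0<-x⁻¹))))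
    where
    0<-x⁻¹ : 0ℝ < - (x ⁻¹)
    0<-x⁻¹ = subst (0ℝ <_) (+-identityˡ _) (x<y⇒0<y-x x⁻¹<0)
    x*-x⁻¹≡0-1 : x * - (x ⁻¹) ≡ 0ℝ - 1ℝ
    x*-x⁻¹≡0-1 = trans (sym (-‿distribʳ-* x (x ⁻¹)))
                   (trans (cong -_ (⁻¹-inverse x (≢-sym (<⇒≢ 0<x)))) (sym (+-identityˡ (- 1ℝ))))

  x*[y*x⁻¹]≡y : ∀ {x} y → 0ℝ < x → x * (y * x ⁻¹) ≡ y
  x*[y*x⁻¹]≡y {x} y 0<x = begin
    x * (y * x ⁻¹)   ≡⟨ x∙yz≈y∙xz x y (x ⁻¹) ⟩
    y * (x * x ⁻¹)   ≡⟨ cong (y *_) (⁻¹-inverse x (≢-sym (<⇒≢ 0<x))) ⟩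
    y * 1ℝ           ≡⟨ *-identityʳ y ⟩
    y                ∎
    where open ≡-Reasoning

  x*y≡0⇒x≡0 : ∀ {x y} → 0ℝ ≤ x → 0ℝ < y → x * y ≡ 0ℝ → x ≡ 0ℝ
  x*y≡0⇒x≡0 (inj₁ 0<x) 0<y xy≡0 = ⊥-elim (<⇒≢ (*-pos 0<x 0<y) (sym xy≡0))
  x*y≡0⇒x≡0 (inj₂ 0≡x) _ _ = sym 0≡x

  0≤x⇒∣x∣≡x : ∀ {x} → 0ℝ ≤ x → ∣ x ∣ ≡ x
  0≤x⇒∣x∣≡x {x} 0≤x with compare x 0ℝ
  ... | tri< x<0 _ _ = ⊥-elim (≤⇒≯ 0≤x x<0)
  ... | tri≈ _ _ _ = refl
  ... | tri> _ _ _ = refl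

  ∃-strictly-between-0-1 : ∃ λ h → 0ℝ < h × h < 1ℝ
  ∃-strictly-between-0-1 = h , 0<h , 0<y-x⇒x<y (subst (0ℝ <_) (sym 1-h≡h) 0<h)
    where
    0<2 : 0ℝ < 1ℝ + 1ℝ
    0<2 = +-pos-nonneg 0<1 (inj₁ 0<1)
    h = (1ℝ + 1ℝ) ⁻¹
    0<h : 0ℝ < h
    0<h = ⁻¹-pos 0<2
    1-h≡h : 1ℝ - h ≡ h
    1-h≡h = begin
      1ℝ - h                 ≡⟨ cong (_- h) (sym (⁻¹-inverse (1ℝ + 1ℝ) (≢-sym (<⇒≢ 0<2)))) ⟩
      (1ℝ + 1ℝ) * h - h      ≡⟨ cong (_- h) (distribʳ h 1ℝ 1ℝ) ⟩
      (1ℝ * h + 1ℝ * h) - h  ≡⟨ cong (λ z → (z + z) - h) (*-identityˡ h) ⟩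
      (h + h) - h            ≡⟨ //-rightDividesʳ h h ⟩
      h                      ∎
      where open ≡-Reasoning

  ∃-lowerBound-of-positives : ∀ {n} (f : Fin n → ℝ) →
    ∃ λ δ → 0ℝ < δ × δ < 1ℝ × (∀ i → 0ℝ < f i → δ ≤ f i)
  ∃-lowerBound-of-positives {zero} f with ∃-strictly-between-0-1
  ... | h , 0<h , h<1 = h , 0<h , h<1 , λ ()
  ∃-lowerBound-of-positives {suc n} f with ∃-lowerBound-of-positives (f ∘ suc)
  ... | δ , 0<δ , δ<1 , δ≤f with compare 0ℝ (f zero) | compare (f zero) δ
  ... | tri< 0<f₀ _ _ | tri< f₀<δ _ _ = f zero , 0<f₀ , <-trans f₀<δ δ<1 , λ
    { zero _ → inj₂ refl ; (suc i) 0<fᵢ → ≤-trans (inj₁ f₀<δ) (δ≤f i 0<fᵢ) }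
  ... | tri< _ _ _ | tri≈ _ f₀≡δ _ = δ , 0<δ , δ<1 , λ
    { zero _ → inj₂ (sym f₀≡δ) ; (suc i) → δ≤f i }
  ... | tri< _ _ _ | tri> _ _ δ<f₀ = δ , 0<δ , δ<1 , λ
    { zero _ → inj₁ δ<f₀ ; (suc i) → δ≤f i }
  ... | tri≈ _ 0≡f₀ _ | _ = δ , 0<δ , δ<1 , λ
    { zero 0<f₀ → ⊥-elim (<⇒≢ 0<f₀ 0≡f₀) ; (suc i) → δ≤f i }
  ... | tri> _ _ f₀<0 | _ = δ , 0<δ , δ<1 , λ
    { zero 0<f₀ → ⊥-elim (<-asym 0<f₀ f₀<0) ; (suc i) → δ≤f i }

module FiniteSums (R : Reals) where
  open Reals R
  open OrderedField R

  open import Algebra.Properties.Semiring.Sum semiring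
    using (sum; sum-cong-≗; sum-replicate-zero; ∑-distrib-+; ∑-comm; *-distribˡ-sum; *-distribʳ-sum)

  Σ≡sum : ∀ {n} (f : Fin n → ℝ) → Σ[ f ] ≡ sum f
  Σ≡sum {zero} f = refl
  Σ≡sum {suc n} f = cong (f zero +_) (Σ≡sum (f ∘ suc))

  Σ-cong : ∀ {n} {f g : Fin n → ℝ} → (∀ i → f i ≡ g i) → Σ[ f ] ≡ Σ[ g ]
  Σ-cong {f = f} {g} f≗g = trans (Σ≡sum f) (trans (sum-cong-≗ {x = f} {y = g} f≗g) (sym (Σ≡sum g)))

  Σ-zero : ∀ {n} → Σ[ (λ (_ : Fin n) → 0ℝ) ] ≡ 0ℝ
  Σ-zero {n} = trans (Σ≡sum {n} (λ _ → 0ℝ)) (sum-replicate-zero n)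

  Σ-distrib-+ : ∀ {n} (f g : Fin n → ℝ) → Σ[ (λ i → f i + g i) ] ≡ Σ[ f ] + Σ[ g ]
  Σ-distrib-+ f g =
    trans (Σ≡sum (λ i → f i + g i)) (trans (∑-distrib-+ f g) (sym (cong₂ _+_ (Σ≡sum f) (Σ≡sum g))))

  *-distribˡ-Σ : ∀ {n} c (f : Fin n → ℝ) → c * Σ[ f ] ≡ Σ[ (λ i → c * f i) ]
  *-distribˡ-Σ c f =
    trans (cong (c *_) (Σ≡sum f)) (trans (*-distribˡ-sum c f) (sym (Σ≡sum (λ i → c * f i))))

  *-distribʳ-Σ : ∀ {n} c (f : Fin n → ℝ) → Σ[ f ] * c ≡ Σ[ (λ i → f i * c) ]
  *-distribʳ-Σ c f =
    trans (cong (_* c) (Σ≡sum f)) (trans (*-distribʳ-sum c f) (sym (Σ≡sum (λ i → f i * c))))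

  Σ-distrib-- : ∀ {n} (f g : Fin n → ℝ) → Σ[ (λ i → f i - g i) ] ≡ Σ[ f ] - Σ[ g ]
  Σ-distrib-- f g = begin
    Σ[ (λ i → f i - g i) ]             ≡⟨ Σ-distrib-+ f (λ i → - g i) ⟩
    Σ[ f ] + Σ[ (λ i → - g i) ]        ≡⟨ cong (Σ[ f ] +_) (Σ-cong (λ i → sym (-1*x≈-x (g i)))) ⟩
    Σ[ f ] + Σ[ (λ i → - 1ℝ * g i) ]   ≡⟨ cong (Σ[ f ] +_) (sym (*-distribˡ-Σ (- 1ℝ) g)) ⟩
    Σ[ f ] + - 1ℝ * Σ[ g ]             ≡⟨ cong (Σ[ f ] +_) (-1*x≈-x Σ[ g ]) ⟩
    Σ[ f ] - Σ[ g ]                    ∎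
    where open ≡-Reasoning

  Σ-comm : ∀ {m n} (f : Fin m → Fin n → ℝ) →
           Σ[ (λ i → Σ[ (λ j → f i j) ]) ] ≡ Σ[ (λ j → Σ[ (λ i → f i j) ]) ]
  Σ-comm f = begin
    Σ[ (λ i → Σ[ f i ]) ]
      ≡⟨ Σ≡sum (λ i → Σ[ f i ]) ⟩
    sum (λ i → Σ[ f i ])
      ≡⟨ sum-cong-≗ {x = λ i → Σ[ f i ]} (λ i → Σ≡sum (f i)) ⟩
    sum (λ i → sum (f i))
      ≡⟨ ∑-comm f ⟩
    sum (λ j → sum (λ i → f i j))
      ≡⟨ sum-cong-≗ {y = λ j → Σ[ (λ i → f i j) ]} (λ j → sym (Σ≡sum (λ i → f i j))) ⟩
    sum (λ j → Σ[ (λ i → f i j) ])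
      ≡⟨ sym (Σ≡sum (λ j → Σ[ (λ i → f i j) ])) ⟩
    Σ[ (λ j → Σ[ (λ i → f i j) ]) ]
      ∎
    where open ≡-Reasoning

  Σ-nonneg : ∀ {n} {f : Fin n → ℝ} → (∀ i → 0ℝ ≤ f i) → 0ℝ ≤ Σ[ f ]
  Σ-nonneg {zero} _ = inj₂ refl
  Σ-nonneg {suc n} f≥0 = +-nonneg (f≥0 zero) (Σ-nonneg (f≥0 ∘ suc))

  f≤Σf : ∀ {n} {f : Fin n → ℝ} → (∀ i → 0ℝ ≤ f i) → ∀ i → f i ≤ Σ[ f ]
  f≤Σf {f = f} f≥0 zero =
    subst (_≤ Σ[ f ]) (+-identityʳ (f zero)) (+-monoʳ-≤ (f zero) (Σ-nonneg (f≥0 ∘ suc)))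
  f≤Σf {f = f} f≥0 (suc i) =
    ≤-trans (f≤Σf (f≥0 ∘ suc) i) (subst (_≤ Σ[ f ]) (+-identityˡ _) (+-monoˡ-≤ _ (f≥0 zero)))

  Σ≡0⇒f≡0 : ∀ {n} {f : Fin n → ℝ} → (∀ i → 0ℝ ≤ f i) → Σ[ f ] ≡ 0ℝ → ∀ i → f i ≡ 0ℝ
  Σ≡0⇒f≡0 f≥0 Σf≡0 i = ≤-antisym (subst (_ ≤_) Σf≡0 (f≤Σf f≥0 i)) (f≥0 i)

module Median (R : Reals) where
  open Reals R
  open OrderedField R

  zeros : ∀ {m} → Vec ℝ m → ℕ
  zeros = count (_≟ 0ℝ)

  data ZerosThenPositives : ∀ {m} → ℕ → Vec ℝ m → Set where
    positives : ∀ {m} {s : Vec ℝ m} → All (0ℝ <_) s → ZerosThenPositives 0 s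
    0∷_       : ∀ {m k} {s : Vec ℝ m} → ZerosThenPositives k s → ZerosThenPositives (suc k) (0ℝ ∷ s)

  insert⁺ : ∀ {p} {P : ℝ → Set p} {m a} {s : Vec ℝ m} → P a → All P s → All P (insert a s)
  insert⁺ pa [] = pa ∷ []
  insert⁺ {a = a} {b ∷ s} pa (pb ∷ ps) with compare a b
  ... | tri< _ _ _ = pa ∷ pb ∷ ps
  ... | tri≈ _ _ _ = pa ∷ pb ∷ ps
  ... | tri> _ _ _ = pb ∷ insert⁺ pa ps

  insert-positive : ∀ {m k a} {s : Vec ℝ m} → 0ℝ < a →
                    ZerosThenPositives k s → ZerosThenPositives k (insert a s)
  insert-positive 0<a (positives ps) = positives (insert⁺ 0<a ps)
  insert-positive {a = a} 0<a (0∷ z) with compare a 0ℝ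
  ... | tri< a<0 _ _ = ⊥-elim (<-asym 0<a a<0)
  ... | tri≈ _ a≡0 _ = ⊥-elim (<⇒≢ 0<a (sym a≡0))
  ... | tri> _ _ _ = 0∷ insert-positive 0<a z

  insert-zero : ∀ {m k} {s : Vec ℝ m} →
                ZerosThenPositives k s → ZerosThenPositives (suc k) (insert 0ℝ s)
  insert-zero (positives []) = 0∷ positives []
  insert-zero (positives {s = b ∷ s} (0<b ∷ ps)) with compare 0ℝ b
  ... | tri< _ _ _ = 0∷ positives (0<b ∷ ps)
  ... | tri≈ _ 0≡b _ = ⊥-elim (<⇒≢ 0<b 0≡b)
  ... | tri> _ _ b<0 = ⊥-elim (<-asym 0<b b<0)
  insert-zero (0∷ z) with compare 0ℝ 0ℝ
  ... | tri< _ _ _ = 0∷ 0∷ z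
  ... | tri≈ _ _ _ = 0∷ 0∷ z
  ... | tri> _ _ _ = 0∷ insert-zero z

  sort-zerosThenPositives : ∀ {m} {s : Vec ℝ m} → All (0ℝ ≤_) s → ZerosThenPositives (zeros s) (sort s)
  sort-zerosThenPositives [] = positives []
  sort-zerosThenPositives {s = a ∷ s} (0≤a ∷ ps) with a ≟ 0ℝ | 0≤a
  ... | yes refl | _ = insert-zero (sort-zerosThenPositives ps)
  ... | no _ | inj₁ 0<a = insert-positive 0<a (sort-zerosThenPositives ps)
  ... | no a≢0 | inj₂ 0≡a = ⊥-elim (a≢0 (sym 0≡a))

  lookup-zeros : ∀ {m k} {s : Vec ℝ m} → ZerosThenPositives k s →
                 ∀ i → toℕ i ℕ.< k → lookup s i ≡ 0ℝ
  lookup-zeros (0∷ z) zero _ = refl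
  lookup-zeros (0∷ z) (suc i) (ℕ.s≤s i<k) = lookup-zeros z i i<k

  lookup-positives : ∀ {m k} {s : Vec ℝ m} → ZerosThenPositives k s →
                     ∀ i → k ℕ.≤ toℕ i → 0ℝ < lookup s i
  lookup-positives (positives ps) i _ = lookup⁺ ps i
  lookup-positives (0∷ z) (suc i) (ℕ.s≤s k≤i) = lookup-positives z i k≤i

  zeros-map-mono : ∀ {a} {A : Set a} {m} (f g : A → ℝ) {X : Vec A m} →
                   All (λ x → f x ≡ 0ℝ → g x ≡ 0ℝ) X → zeros (map f X) ℕ.≤ zeros (map g X)
  zeros-map-mono f g [] = ℕ.z≤n
  zeros-map-mono f g {x ∷ X} (fx≡0⇒gx≡0 ∷ hs) with f x ≟ 0ℝ | g x ≟ 0ℝ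
  ... | yes fx≡0 | no gx≢0 = ⊥-elim (gx≢0 (fx≡0⇒gx≡0 fx≡0))
  ... | yes _ | yes _ = ℕ.s≤s (zeros-map-mono f g hs)
  ... | no _ | yes _ = ℕP.m≤n⇒m≤1+n (zeros-map-mono f g hs)
  ... | no _ | no _ = zeros-map-mono f g hs

  module _ (ℓ : ℕ) {xs : Vec ℝ (suc (ℓ ℕ.+ ℓ))} (xs≥0 : All (0ℝ ≤_) xs) where
    private
      sorted = sort-zerosThenPositives xs≥0
      i = fromℕ ℓ ↑ˡ ℓ

      toℕ-i : toℕ i ≡ ℓ
      toℕ-i = trans (FinP.toℕ-↑ˡ (fromℕ ℓ) ℓ) (FinP.toℕ-fromℕ ℓ)

      median-pos : ¬ ℓ ℕ.< zeros xs → 0ℝ < median ℓ xs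
      median-pos ℓ≮zeros =
        lookup-positives sorted i (subst (zeros xs ℕ.≤_) (sym toℕ-i) (ℕP.≮⇒≥ ℓ≮zeros))

    median≡0⇒ℓ<zeros : median ℓ xs ≡ 0ℝ → ℓ ℕ.< zeros xs
    median≡0⇒ℓ<zeros med≡0 with ℓ ℕ.<? zeros xs
    ... | yes ℓ<zeros = ℓ<zeros
    ... | no ℓ≮zeros = ⊥-elim (<⇒≢ (median-pos ℓ≮zeros) (sym med≡0))

    ℓ<zeros⇒median≡0 : ℓ ℕ.< zeros xs → median ℓ xs ≡ 0ℝ
    ℓ<zeros⇒median≡0 ℓ<zeros = lookup-zeros sorted i (subst (ℕ._< zeros xs) (sym toℕ-i) ℓ<zeros)

    median-nonneg : 0ℝ ≤ median ℓ xs
    median-nonneg with ℓ ℕ.<? zeros xs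
    ... | yes ℓ<zeros = inj₂ (sym (ℓ<zeros⇒median≡0 ℓ<zeros))
    ... | no ℓ≮zeros = inj₁ (median-pos ℓ≮zeros)

  module _ {n} (ℓ : ℕ) (X : Vec (Fin n → ℝ) (suc (ℓ ℕ.+ ℓ))) where
    medianVec-nonneg : ∀ {v} → All (λ x → 0ℝ ≤ x v) X → 0ℝ ≤ medianVec ℓ X v
    medianVec-nonneg X≥0 = median-nonneg ℓ (map⁺ X≥0)

    medianVec-zero-inherited : ∀ {u v} → All (λ x → 0ℝ ≤ x u) X → All (λ x → 0ℝ ≤ x v) X →
                               All (λ x → x v ≡ 0ℝ → x u ≡ 0ℝ) X →
                               medianVec ℓ X v ≡ 0ℝ → medianVec ℓ X u ≡ 0ℝ
    medianVec-zero-inherited {u} {v} Xu≥0 Xv≥0 zero-inherited medᵥ≡0 =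
      ℓ<zeros⇒median≡0 ℓ (map⁺ Xu≥0) (ℕP.<-≤-trans ℓ<zerosᵥ zerosᵥ≤zerosᵤ)
      where
      ℓ<zerosᵥ = median≡0⇒ℓ<zeros ℓ (map⁺ Xv≥0) medᵥ≡0
      zerosᵥ≤zerosᵤ = zeros-map-mono (λ x → x v) (λ x → x u) zero-inherited

module PageRankVectors (R : Reals) where
  open Reals R
  open OrderedField R
  open FiniteSums R
  open Median R

  isRanking : ∀ {n} {x : Fin n → ℝ} → (∀ v → 0ℝ ≤ x v) → Σ[ x ] ≡ 1ℝ → IsRanking x
  isRanking {x = x} x≥0 Σx≡1 = (λ v → x≥0 v , subst (x v ≤_) Σx≡1 (f≤Σf x≥0 v)) , Σx≡1

  module _ {n : ℕ} (G : Graph n) where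
    open Graph G

    outdeg-pos : ∀ u → 0ℝ < outdeg G u
    outdeg-pos u with hasOut u
    ... | v , uv∈E = <-≤-trans (subst (λ b → 0ℝ < (if b then 1ℝ else 0ℝ)) (sym uv∈E) 0<1)
                               (f≤Σf (λ w → indicator-nonneg (edge u w)) v)
      where
      indicator-nonneg : ∀ b → 0ℝ ≤ (if b then 1ℝ else 0ℝ)
      indicator-nonneg true = inj₁ 0<1
      indicator-nonneg false = inj₂ refl

    M-nonneg : ∀ u v → 0ℝ ≤ M G u v
    M-nonneg u v with edge u v
    ... | true = inj₁ (⁻¹-pos (outdeg-pos u))
    ... | false = inj₂ refl

    M-pos : ∀ {u v} → edge u v ≡ true → 0ℝ < M G u v
    M-pos {u} {v} uv∈E with edge u v
    ... | true = ⁻¹-pos (outdeg-pos u)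

    Σ-M : ∀ u → Σ[ M G u ] ≡ 1ℝ
    Σ-M u = begin
      Σ[ M G u ]                      ≡⟨ Σ-cong M≡indicator*outdeg⁻¹ ⟩
      Σ[ (λ v → indicator v * d⁻¹) ]  ≡⟨ sym (*-distribʳ-Σ d⁻¹ indicator) ⟩
      outdeg G u * d⁻¹                ≡⟨ ⁻¹-inverse _ (≢-sym (<⇒≢ (outdeg-pos u))) ⟩
      1ℝ                              ∎
      where
      open ≡-Reasoning
      d⁻¹ = outdeg G u ⁻¹
      indicator : Fin n → ℝ
      indicator v = if edge u v then 1ℝ else 0ℝ
      M≡indicator*outdeg⁻¹ : ∀ v → M G u v ≡ indicator v * d⁻¹
      M≡indicator*outdeg⁻¹ v with edge u v
      ... | true = sym (*-identityˡ d⁻¹)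
      ... | false = sym (zeroˡ d⁻¹)

    ZerosBackwardClosed : (Fin n → ℝ) → Set
    ZerosBackwardClosed x = ∀ {u v} → edge u v ≡ true → x v ≡ 0ℝ → x u ≡ 0ℝ

    ∈𝒫⇒nonneg : ∀ {x} → x ∈𝒫 G → ∀ v → 0ℝ ≤ x v
    ∈𝒫⇒nonneg (_ , _ , _ , _ , (x∈[0,1] , _) , _) v = proj₁ (x∈[0,1] v)

    ∈𝒫⇒zerosBackwardClosed : ∀ {x} → x ∈𝒫 G → ZerosBackwardClosed x
    ∈𝒫⇒zerosBackwardClosed {x} x∈𝒫@(r , ε , (r∈[0,1] , _) , (0<ε , ε<1) , _ , stationary)
                           {u} {v} uv∈E xv≡0 =
      x*y≡0⇒x≡0 (x≥0 u) (+-pos-nonneg (*-pos 0<1-ε (M-pos uv∈E)) εrᵥ≥0)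
                (Σ≡0⇒f≡0 term≥0 (trans (sym (stationary v)) xv≡0) u)
      where
      x≥0 = ∈𝒫⇒nonneg x∈𝒫
      0<1-ε : 0ℝ < 1ℝ - ε
      0<1-ε = x<y⇒0<y-x ε<1
      εrᵥ≥0 : 0ℝ ≤ ε * r v
      εrᵥ≥0 = *-nonneg (inj₁ 0<ε) (proj₁ (r∈[0,1] v))
      term≥0 : ∀ w → 0ℝ ≤ x w * ((1ℝ - ε) * M G w v + ε * r v)
      term≥0 w = *-nonneg (x≥0 w) (+-nonneg (*-nonneg (inj₁ 0<1-ε) (M-nonneg w v)) εrᵥ≥0)

    walkStep : (Fin n → ℝ) → Fin n → ℝ
    walkStep x v = Σ[ (λ u → x u * M G u v) ]

    walkStep-nonneg : ∀ {x} → (∀ v → 0ℝ ≤ x v) → ∀ v → 0ℝ ≤ walkStep x v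
    walkStep-nonneg x≥0 v = Σ-nonneg (λ u → *-nonneg (x≥0 u) (M-nonneg u v))

    Σ-walkStep : ∀ x → Σ[ walkStep x ] ≡ Σ[ x ]
    Σ-walkStep x = begin
      Σ[ (λ v → Σ[ (λ u → x u * M G u v) ]) ]
        ≡⟨ Σ-comm (λ v u → x u * M G u v) ⟩
      Σ[ (λ u → Σ[ (λ v → x u * M G u v) ]) ]
        ≡⟨ Σ-cong (λ u → sym (*-distribˡ-Σ (x u) (M G u))) ⟩
      Σ[ (λ u → x u * Σ[ M G u ]) ]
        ≡⟨ Σ-cong (λ u → trans (cong (x u *_) (Σ-M u)) (*-identityʳ (x u))) ⟩
      Σ[ x ]
        ∎
      where open ≡-Reasoning

    walkStep-zero : ∀ {x} → ZerosBackwardClosed x → ∀ {v} → x v ≡ 0ℝ → walkStep x v ≡ 0ℝ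
    walkStep-zero {x} closed {v} xv≡0 = trans (Σ-cong term≡0) (Σ-zero {n})
      where
      term≡0 : ∀ u → x u * M G u v ≡ 0ℝ
      term≡0 u with edge u v in uv
      ... | true = trans (cong (_* _) (closed uv xv≡0)) (zeroˡ _)
      ... | false = zeroʳ (x u)

    module Decomposition {x : Fin n → ℝ} (x≥0 : ∀ v → 0ℝ ≤ x v) (Σx≡1 : Σ[ x ] ≡ 1ℝ)
                         {δ : ℝ} (0<δ : 0ℝ < δ) (δ<1 : δ < 1ℝ)
                         (δy≤x : ∀ v → δ * walkStep x v ≤ x v) where
      ε : ℝ
      ε = 1ℝ - δ

      0<ε : 0ℝ < ε
      0<ε = x<y⇒0<y-x δ<1

      ε<1 : ε < 1ℝ
      ε<1 = 0<y-x⇒x<y (subst (0ℝ <_) (sym (x-[x-y]≡y 1ℝ δ)) 0<δ)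

      reset : Fin n → ℝ
      reset v = (x v - δ * walkStep x v) * ε ⁻¹

      reset≥0 : ∀ v → 0ℝ ≤ reset v
      reset≥0 v = *-nonneg (x≤y⇒0≤y-x (δy≤x v)) (inj₁ (⁻¹-pos 0<ε))

      Σ-reset : Σ[ reset ] ≡ 1ℝ
      Σ-reset = begin
        Σ[ reset ]
          ≡⟨ sym (*-distribʳ-Σ (ε ⁻¹) (λ v → x v - δ * walkStep x v)) ⟩
        Σ[ (λ v → x v - δ * walkStep x v) ] * ε ⁻¹
          ≡⟨ cong (_* ε ⁻¹) (Σ-distrib-- x (λ v → δ * walkStep x v)) ⟩
        (Σ[ x ] - Σ[ (λ v → δ * walkStep x v) ]) * ε ⁻¹
          ≡⟨ cong (λ s → (Σ[ x ] - s) * ε ⁻¹) (sym (*-distribˡ-Σ δ (walkStep x))) ⟩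
        (Σ[ x ] - δ * Σ[ walkStep x ]) * ε ⁻¹
          ≡⟨ cong (λ s → (Σ[ x ] - δ * s) * ε ⁻¹) (Σ-walkStep x) ⟩
        (Σ[ x ] - δ * Σ[ x ]) * ε ⁻¹
          ≡⟨ cong (λ s → (s - δ * s) * ε ⁻¹) Σx≡1 ⟩
        (1ℝ - δ * 1ℝ) * ε ⁻¹
          ≡⟨ cong (λ s → (1ℝ - s) * ε ⁻¹) (*-identityʳ δ) ⟩
        ε * ε ⁻¹
          ≡⟨ ⁻¹-inverse ε (≢-sym (<⇒≢ 0<ε)) ⟩
        1ℝ
          ∎
        where open ≡-Reasoning

      stationary : ∀ v → x v ≡ Σ[ (λ u → x u * ((1ℝ - ε) * M G u v + ε * reset v)) ]
      stationary v = sym (begin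
        Σ[ (λ u → x u * ((1ℝ - ε) * M G u v + ε * reset v)) ]
          ≡⟨ Σ-cong (λ u → distribˡ (x u) _ _) ⟩
        Σ[ (λ u → x u * ((1ℝ - ε) * M G u v) + x u * (ε * reset v)) ]
          ≡⟨ Σ-distrib-+ (λ u → x u * ((1ℝ - ε) * M G u v)) (λ u → x u * (ε * reset v)) ⟩
        Σ[ (λ u → x u * ((1ℝ - ε) * M G u v)) ] + Σ[ (λ u → x u * (ε * reset v)) ]
          ≡⟨ cong₂ _+_ (Σ-cong (λ u → x∙yz≈y∙xz (x u) (1ℝ - ε) (M G u v)))
                       (sym (*-distribʳ-Σ (ε * reset v) x)) ⟩
        Σ[ (λ u → (1ℝ - ε) * (x u * M G u v)) ] + Σ[ x ] * (ε * reset v)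
          ≡⟨ cong₂ _+_ (sym (*-distribˡ-Σ (1ℝ - ε) (λ u → x u * M G u v)))
                       (trans (cong (_* (ε * reset v)) Σx≡1) (*-identityˡ (ε * reset v))) ⟩
        (1ℝ - ε) * walkStep x v + ε * reset v
          ≡⟨ cong₂ (λ a b → a * walkStep x v + b) (x-[x-y]≡y 1ℝ δ) (x*[y*x⁻¹]≡y _ 0<ε) ⟩
        δ * walkStep x v + (x v - δ * walkStep x v)
          ≡⟨ x+[y-x]≡y (δ * walkStep x v) (x v) ⟩
        x v ∎)
        where open ≡-Reasoning

      ∈𝒫 : x ∈𝒫 G
      ∈𝒫 = reset , ε , isRanking reset≥0 Σ-reset , (0<ε , ε<1) , isRanking x≥0 Σx≡1 , stationary

    ∈𝒫-intro : ∀ {x} → (∀ v → 0ℝ ≤ x v) → Σ[ x ] ≡ 1ℝ → ZerosBackwardClosed x → x ∈𝒫 G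
    ∈𝒫-intro {x} x≥0 Σx≡1 closed with ∃-lowerBound-of-positives x
    ... | δ , 0<δ , δ<1 , δ≤x = Decomposition.∈𝒫 x≥0 Σx≡1 0<δ δ<1 δy≤x
      where
      δy≤x : ∀ v → δ * walkStep x v ≤ x v
      δy≤x v with x≥0 v
      ... | inj₂ 0≡xv =
        inj₂ (trans (cong (δ *_) (walkStep-zero closed (sym 0≡xv))) (trans (zeroʳ δ) 0≡xv))
      ... | inj₁ 0<xv = ≤-trans (*-monoˡ-≤-nonneg (inj₁ 0<δ) y≤1)
                                (subst (_≤ x v) (sym (*-identityʳ δ)) (δ≤x v 0<xv))
        where
        y≤1 : walkStep x v ≤ 1ℝ
        y≤1 = subst (walkStep x v ≤_) (trans (Σ-walkStep x) Σx≡1) (f≤Σf (walkStep-nonneg x≥0) v)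

    ∈𝒫-normalise : ∀ {y} → (∀ v → 0ℝ ≤ y v) → ZerosBackwardClosed y → 0ℝ < ‖ y ‖₁ →
                   (λ v → y v * ‖ y ‖₁ ⁻¹) ∈𝒫 G
    ∈𝒫-normalise {y} y≥0 closed 0<‖y‖ =
      ∈𝒫-intro (λ v → *-nonneg (y≥0 v) (inj₁ 0<c)) Σ-normalised closed′
      where
      c = ‖ y ‖₁ ⁻¹
      0<c : 0ℝ < c
      0<c = ⁻¹-pos 0<‖y‖
      Σ-normalised : Σ[ (λ v → y v * c) ] ≡ 1ℝ
      Σ-normalised = begin
        Σ[ (λ v → y v * c) ]   ≡⟨ sym (*-distribʳ-Σ c y) ⟩
        Σ[ y ] * c             ≡⟨ cong (_* c) (Σ-cong (λ v → sym (0≤x⇒∣x∣≡x (y≥0 v)))) ⟩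
        ‖ y ‖₁ * c             ≡⟨ ⁻¹-inverse ‖ y ‖₁ (≢-sym (<⇒≢ 0<‖y‖)) ⟩
        1ℝ                     ∎
        where open ≡-Reasoning
      closed′ : ZerosBackwardClosed (λ v → y v * c)
      closed′ {v = v} uv∈E yᵥc≡0 =
        trans (cong (_* c) (closed uv∈E (x*y≡0⇒x≡0 (y≥0 v) 0<c yᵥc≡0))) (zeroˡ c)

    module _ (ℓ : ℕ) {X : Vec (Fin n → ℝ) (suc (ℓ ℕ.+ ℓ))} (X⊆𝒫 : All (λ x → x ∈𝒫 G) X) where
      private
        X≥0 : ∀ v → All (λ x → 0ℝ ≤ x v) X
        X≥0 v = All.map (λ x∈𝒫 → ∈𝒫⇒nonneg x∈𝒫 v) X⊆𝒫

      ∈𝒫⇒medianVec-nonneg : ∀ v → 0ℝ ≤ medianVec ℓ X v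
      ∈𝒫⇒medianVec-nonneg v = medianVec-nonneg ℓ X (X≥0 v)

      ∈𝒫⇒medianVec-zerosBackwardClosed : ZerosBackwardClosed (medianVec ℓ X)
      ∈𝒫⇒medianVec-zerosBackwardClosed uv∈E =
        medianVec-zero-inherited ℓ X (X≥0 _) (X≥0 _)
          (All.map (λ x∈𝒫 → ∈𝒫⇒zerosBackwardClosed x∈𝒫 uv∈E) X⊆𝒫)

theorem21 : (R : Reals) → let open Reals R in
    ∀ {n : ℕ} (G : Graph n) (ℓ : ℕ) (X : Vec (Fin n → ℝ) (suc (ℓ ℕ.+ ℓ))) →
    All (λ x → x ∈𝒫 G) X →
    0ℝ < ‖ medianVec ℓ X ‖₁ →
    Rmed ℓ X ∈𝒫 G
theorem21 R G ℓ X X⊆𝒫 0<‖med‖ =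
  ∈𝒫-normalise G (∈𝒫⇒medianVec-nonneg G ℓ X⊆𝒫)
                 (∈𝒫⇒medianVec-zerosBackwardClosed G ℓ X⊆𝒫)
                 0<‖med‖
  where open PageRankVectors R
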